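{- Let $H_1,\ldots,H_k$ be finite simple graphs, and let $n(H_i)$ denote the number of vertices of $H_i$. Then $$f(H_1,\ldots,H_k)\le 2\sum_{i=1}^k\bigl(n(H_i)-1\bigr).$$
   Context: All graphs are finite and simple. A graph $G$ is $(H_1,\ldots,H_k)$-full if every vertex of $G$ belongs to an induced subgraph of $G$ isomorphic to $H_i$, for each $i=1,\ldots,k$. $f(H_1,\ldots,H_k)$ denotes the minimum number of vertices of an $(H_1,\ldots,H_k)$-full graph. -}

module Defs where

open import Data.Nat using (ℕ; _∸_; _≤_; _*_)
open import Data.Bool using (Bool; false)
open import Data.Fin using (Fin)
open import Data.List using (map; allFin)
open import Data.Nat.ListAction using (sum)
open import Data.Product using (Σ; ∃; _×_; _,_)
open import Relation.Binary.PropositionalEquality using (_≡_)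
open import Function.Definitions using (Injective)

record Graph : Set where
  field
    n      : ℕ
    adj    : Fin n → Fin n → Bool
    sym    : ∀ u v → adj u v ≡ adj v u
    irrefl : ∀ v → adj v v ≡ false
open Graph public

record InducedEmbedding (H G : Graph) : Set where
  field
    φ       : Fin (n H) → Fin (n G)
    inj     : Injective _≡_ _≡_ φ
    preserv : ∀ a b → adj H a b ≡ adj G (φ a) (φ b)
open InducedEmbedding public

InInducedCopy : (H G : Graph) → Fin (n G) → Set
InInducedCopy H G v = Σ (InducedEmbedding H G) λ e → ∃ λ a → φ e a ≡ v

Full : (k : ℕ) → (Fin k → Graph) → Graph → Set
Full k H G = ∀ (v : Fin (n G)) (i : Fin k) → InInducedCopy (H i) G v

bound : (k : ℕ) → (Fin k → Graph) → ℕ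
bound k H = 2 * sum (map (λ i → n (H i) ∸ 1) (allFin k))

{-# OPTIONS --safe #-}
module Submission where

-- Write Hᵢ⁻ for Hᵢ minus vertex 0 and Pᵢ for the neighbourhood of vertex 0 in Hᵢ⁻.
-- G consists of two copies (sides s : Bool) of every Hᵢ⁻, so it has 2 Σ (n(Hᵢ) − 1)
-- vertices.  Vertices in different blocks are adjacent iff their labels differ,
-- the label of (s , i , a) being s xor Pᵢ(a); so every vertex x outside block j sees
-- the copy of Hⱼ⁻ on side label(x) exactly along Pⱼ, and completes it to an induced Hⱼ.
-- Inside block j the two sides are joined so that vertex 0 of either side plays the
-- role of vertex 0 of Hⱼ for the other side, which covers the vertices of block j.

open import Defs
open import Data.Bool using (Bool; true; false; not; _xor_; if_then_else_)
open import Data.Bool.Properties using (xor-comm; xor-same; not-involutive; not-distribˡ-xor; not-¬)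
open import Data.Fin using (Fin; zero; suc; fromℕ<)
open import Data.Fin.Properties using (_≟_; +↔⊎; *↔×; 2↔Bool; nonZeroIndex)
open import Data.List using (map; allFin; tabulate)
open import Data.List.Properties using (map-tabulate)
open import Data.Nat using (ℕ; zero; suc; _∸_; _≤_; >-nonZero⁻¹)
open import Data.Nat.ListAction using (sum)
open import Data.Nat.Properties using (≤-refl; ∸-monoˡ-≤)
open import Data.Product using (Σ; ∃; _×_; _,_; proj₁; proj₂)
open import Data.Product.Algebra using (×-cong)
open import Data.Sum using (_⊎_; inj₁; inj₂)
open import Data.Sum.Algebra using (⊎-cong)
open import Function using (_∘_; id; _↔_; Inverse; Injection; mk↔ₛ′)
open import Function.Definitions using (Injective)
open import Function.Properties.Inverse using (↔-refl; ↔-sym; ↔-trans; ↔⇒↣)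
open import Relation.Binary.PropositionalEquality as ≡ using (_≡_; _≢_; refl; cong; cong₂; subst)
open import Relation.Nullary using (yes; no; contradiction)

xor-cancelˡ : ∀ x y → x xor (x xor y) ≡ y
xor-cancelˡ false y = refl
xor-cancelˡ true  y = not-involutive y

⊎↔Σ-Fin-suc : ∀ {k} {B : Fin (suc k) → Set} → (B zero ⊎ Σ (Fin k) (B ∘ suc)) ↔ Σ (Fin (suc k)) B
⊎↔Σ-Fin-suc = mk↔ₛ′
  (λ { (inj₁ b) → zero , b ; (inj₂ (i , b)) → suc i , b })
  (λ { (zero , b) → inj₁ b ; (suc i , b) → inj₂ (i , b) })
  (λ { (zero , b) → refl ; (suc i , b) → refl })
  (λ { (inj₁ b) → refl ; (inj₂ _) → refl })

Fin-sum-tabulate↔Σ : ∀ {k} (m : Fin k → ℕ) → Fin (sum (tabulate m)) ↔ Σ (Fin k) (Fin ∘ m)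
Fin-sum-tabulate↔Σ {zero}  m = mk↔ₛ′ (λ ()) (λ ()) (λ ()) (λ ())
Fin-sum-tabulate↔Σ {suc k} m =
  ↔-trans +↔⊎ (↔-trans (⊎-cong ↔-refl (Fin-sum-tabulate↔Σ (m ∘ suc))) ⊎↔Σ-Fin-suc)

Fin-sum↔Σ : ∀ {k} (m : Fin k → ℕ) → Fin (sum (map m (allFin k))) ↔ Σ (Fin k) (Fin ∘ m)
Fin-sum↔Σ m =
  subst (λ N → Fin N ↔ Σ (Fin _) (Fin ∘ m)) (cong sum (≡.sym (map-tabulate id m))) (Fin-sum-tabulate↔Σ m)

lift : ∀ {N} → Fin (N ∸ 1) → Fin N
lift {suc N} = suc

rootRow : (H : Graph) → Fin (n H ∸ 1) → Bool
rootRow record { n = suc N ; adj = adjH } b = adjH zero (suc b)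

_◃_ : ∀ {N} {X : Set} → X → (Fin (N ∸ 1) → X) → Fin N → X
_◃_ {suc N} w g zero    = w
_◃_ {suc N} w g (suc a) = g a

◃-lift : ∀ {N} {X : Set} (w : X) (g : Fin (N ∸ 1) → X) a → _◃_ {N} w g (lift a) ≡ g a
◃-lift {suc N} w g a = refl

◃-root : ∀ {N} {X : Set} (w : X) (g : Fin (N ∸ 1) → X) → 1 ≤ N → ∃ λ a → _◃_ {N} w g a ≡ w
◃-root {suc N} w g _ = zero , refl

◃-injective : ∀ {N} {X : Set} {w : X} {g : Fin (N ∸ 1) → X} →
  Injective _≡_ _≡_ g → (∀ b → g b ≢ w) → Injective _≡_ _≡_ (_◃_ {N} w g)
◃-injective {suc N} g-inj w∉g {zero}  {zero}  _ = refl
◃-injective {suc N} g-inj w∉g {zero}  {suc b} e = contradiction (≡.sym e) (w∉g b)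
◃-injective {suc N} g-inj w∉g {suc a} {zero}  e = contradiction e (w∉g a)
◃-injective {suc N} g-inj w∉g {suc a} {suc b} e = cong suc (g-inj e)

◃-preserves : ∀ (H G : Graph) {w : Fin (n G)} {g : Fin (n H ∸ 1) → Fin (n G)} →
  (∀ b → adj G w (g b) ≡ rootRow H b) →
  (∀ b c → adj G (g b) (g c) ≡ adj H (lift b) (lift c)) →
  ∀ a b → adj H a b ≡ adj G (_◃_ {n H} w g a) (_◃_ {n H} w g b)
◃-preserves record { n = suc N ; sym = symH ; irrefl = irreflH } G w-row g-adj = λ where
  zero    zero    → ≡.trans (irreflH zero) (≡.sym (irrefl G _))
  zero    (suc b) → ≡.sym (w-row b)
  (suc a) zero    → ≡.trans (symH (suc a) zero) (≡.trans (≡.sym (w-row a)) (sym G _ _))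
  (suc a) (suc b) → ≡.sym (g-adj a b)

record Cone (H G : Graph) : Set where
  field
    apex           : Fin (n G)
    base           : Fin (n H ∸ 1) → Fin (n G)
    base-injective : Injective _≡_ _≡_ base
    apex∉base      : ∀ b → base b ≢ apex
    apex-adj       : ∀ b → adj G apex (base b) ≡ rootRow H b
    base-adj       : ∀ b c → adj G (base b) (base c) ≡ adj H (lift b) (lift c)

  embedding : InducedEmbedding H G
  embedding = record
    { φ       = apex ◃ base
    ; inj     = ◃-injective base-injective apex∉base
    ; preserv = ◃-preserves H G apex-adj base-adj
    }

  apex-in-copy : 1 ≤ n H → InInducedCopy H G apex
  apex-in-copy 1≤n = embedding , ◃-root apex base 1≤n

  base-in-copy : ∀ b → InInducedCopy H G (base b)
  base-in-copy b = embedding , lift b , ◃-lift {n H} apex base b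

link : ∀ {N} → (Fin N → Bool) → Fin N → Fin N → Bool
link P zero    b       = P b
link P (suc a) zero    = P (suc a)
link P (suc a) (suc b) = false

link-sym : ∀ {N} (P : Fin N → Bool) a b → link P a b ≡ link P b a
link-sym P zero    zero    = refl
link-sym P zero    (suc b) = refl
link-sym P (suc a) zero    = refl
link-sym P (suc a) (suc b) = refl

toZero : ∀ {N} → Fin N → Fin N
toZero zero    = zero
toZero (suc _) = zero

link-toZero : ∀ {N} (P : Fin N → Bool) a b → link P (toZero a) b ≡ P b
link-toZero P zero    b = refl
link-toZero P (suc a) b = refl

module Construction (k : ℕ) (H : Fin k → Graph) where

  m : Fin k → ℕ
  m i = n (H i) ∸ 1

  V : Set
  V = Bool × Σ (Fin k) (Fin ∘ m)

  label : V → Bool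
  label (s , i , a) = s xor rootRow (H i) a

  _~_ : V → V → Bool
  (s , i , a) ~ (t , j , b) with i ≟ j
  ... | yes refl = if s xor t then link (rootRow (H i)) a b else adj (H i) (lift a) (lift b)
  ... | no _     = label (s , i , a) xor label (t , j , b)

  ~-sym : ∀ x y → x ~ y ≡ y ~ x
  ~-sym (s , i , a) (t , j , b) with i ≟ j | j ≟ i
  ... | yes refl | yes refl rewrite xor-comm s t =
    cong₂ (if t xor s then_else_) (link-sym (rootRow (H i)) a b) (sym (H i) (lift a) (lift b))
  ... | yes refl | no i≢i  = contradiction refl i≢i
  ... | no i≢i   | yes refl = contradiction refl i≢i
  ... | no _     | no _     = xor-comm (label (s , i , a)) (label (t , j , b))

  side-adj : ∀ j t b c → (t , j , b) ~ (t , j , c) ≡ adj (H j) (lift b) (lift c)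
  side-adj j t b c with j ≟ j
  ... | yes refl rewrite xor-same t = refl
  ... | no j≢j   = contradiction refl j≢j

  ~-irrefl : ∀ x → x ~ x ≡ false
  ~-irrefl (s , i , a) = ≡.trans (side-adj i s a a) (irrefl (H i) (lift a))

  apex-row-other : ∀ s i j (a : Fin (m i)) → i ≢ j → ∀ b →
    (s , i , a) ~ (label (s , i , a) , j , b) ≡ rootRow (H j) b
  apex-row-other s i j a i≢j b with i ≟ j
  ... | yes i≡j = contradiction i≡j i≢j
  ... | no _    = xor-cancelˡ (label (s , i , a)) (rootRow (H j) b)

  apex-row-same : ∀ s j (a b : Fin (m j)) → (not s , j , toZero a) ~ (s , j , b) ≡ rootRow (H j) b
  apex-row-same s j a b with j ≟ j
  ... | yes refl rewrite ≡.sym (not-distribˡ-xor s s) | xor-same s = link-toZero (rootRow (H j)) a b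
  ... | no j≢j   = contradiction refl j≢j

  vertices : Fin (bound k H) ↔ V
  vertices = ↔-trans *↔× (×-cong 2↔Bool (Fin-sum↔Σ m))

  open Inverse vertices using (to; from; strictlyInverseˡ; strictlyInverseʳ)

  G : Graph
  G = record
    { n      = bound k H
    ; adj    = λ u v → to u ~ to v
    ; sym    = λ u v → ~-sym (to u) (to v)
    ; irrefl = ~-irrefl ∘ to
    }

  adj-from : ∀ x y → adj G (from x) (from y) ≡ x ~ y
  adj-from x y = cong₂ _~_ (strictlyInverseˡ x) (strictlyInverseˡ y)

  from-injective : Injective _≡_ _≡_ from
  from-injective = Injection.injective (↔⇒↣ (↔-sym vertices))

  sideCone : ∀ j t (x : V) → (∀ b → (t , j , b) ≢ x) →
    (∀ b → x ~ (t , j , b) ≡ rootRow (H j) b) → Cone (H j) G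
  sideCone j t x x∉side x-row = record
    { apex           = from x
    ; base           = λ b → from (t , j , b)
    ; base-injective = λ e → side-injective (from-injective e)
    ; apex∉base      = λ b e → x∉side b (from-injective e)
    ; apex-adj       = λ b → ≡.trans (adj-from x _) (x-row b)
    ; base-adj       = λ b c → ≡.trans (adj-from (t , j , b) (t , j , c)) (side-adj j t b c)
    }
    where
      side-injective : ∀ {b c} → (t , j , b) ≡ (t , j , c) → b ≡ c
      side-injective refl = refl

  copy-through : (∀ i → 1 ≤ n (H i)) → ∀ x j → InInducedCopy (H j) G (from x)
  copy-through nonempty (s , i , a) j with i ≟ j
  ... | yes refl = Cone.base-in-copy cone a
    where
      cone = sideCone j s (not s , j , toZero a)
        (λ b e → not-¬ refl (cong proj₁ e)) (apex-row-same s j a)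
  ... | no i≢j = Cone.apex-in-copy cone (nonempty j)
    where
      cone = sideCone j (label (s , i , a)) (s , i , a)
        (λ b e → i≢j (≡.sym (cong (proj₁ ∘ proj₂) e))) (apex-row-other s i j a i≢j)

  full : (∀ i → 1 ≤ n (H i)) → Full k H G
  full nonempty v j =
    subst (InInducedCopy (H j) G) (strictlyInverseʳ v) (copy-through nonempty (to v) j)

  G-nonempty : (∃ λ i → 2 ≤ n (H i)) → 1 ≤ n G
  G-nonempty (i , 2≤nHᵢ) = >-nonZero⁻¹ _ {{nonZeroIndex (from (false , i , a))}}
    where
      a : Fin (m i)
      a = fromℕ< (∸-monoˡ-≤ 1 2≤nHᵢ)

theorem2p1 : (k : ℕ) (H : Fin k → Graph) →
    (∀ i → 1 ≤ n (H i)) →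
    (∃ λ i → 2 ≤ n (H i)) →
    Σ Graph (λ G → (1 ≤ n G) × (n G ≤ bound k H) × Full k H G)
theorem2p1 k H nonempty big = G , G-nonempty big , ≤-refl , full nonempty
  where open Construction k H
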